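{- Let $AP=\{p\}$ and let $L_2$ be the set of Kripke trees $\mathcal{T}$ over $AP$ for which there is an infinite path $\pi$ from the root such that $p\notin\mathit{Lab}(\pi(i))$ for all $i\ge0$ and, for every $i\ge0$, the node $\pi(2i)$ has a child labelled with a set containing $p$ (i.e. $\mathsf{E}\mathsf{X}p$ holds at $\pi(2i)$). Then there is no CCTL$^*$ formula $\varphi$ with $\mathcal{L}(\varphi)=L_2$.
   Context: A Kripke tree over $AP$ is a non-blocking tree (nonempty prefix-closed $T\subseteq D^*$ in which every node has a child; root $\varepsilon$) with labelling $\mathit{Lab}:T\to2^{AP}$; an infinite path from $w$ is a sequence $\pi(0)=w$, $\pi(k+1)$ a child of $\pi(k)$. CCTL$^*$: state formulas $\varphi::=\top\mid p\mid\neg\varphi\mid\varphi\wedge\varphi\mid\mathsf{E}\psi\mid\mathsf{D}^n\varphi$ ($n\ge1$); path formulas $\psi::=\varphi\mid\neg\psi\mid\psi\wedge\psi\mid\mathsf{X}\psi\mid\psi\,\mathsf{U}\,\psi$. $(\mathcal{T},w)\models p$ iff $p\in\mathit{Lab}(w)$; $(\mathcal{T},w)\models\mathsf{E}\psi$ iff $(\mathcal{T},\pi,0)\models\psi$ for some infinite path $\pi$ from $w$; $(\mathcal{T},w)\models\mathsf{D}^n\varphi$ iff at least $n$ distinct children of $w$ satisfy $\varphi$; $(\mathcal{T},\pi,i)\models\varphi$ iff $(\mathcal{T},\pi(i))\models\varphi$; $\mathsf{X}$ and $\mathsf{U}$ have their usual meaning along $\pi$. $\mathcal{L}(\varphi)$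 is the set of Kripke trees $\mathcal{T}$ with $(\mathcal{T},\varepsilon)\models\varphi$. -}

module Defs where

open import Data.Nat using (ℕ; zero; suc; _≤_; _<_; _+_; _*_)
open import Data.Fin using (Fin)
open import Data.List using (List; []; _∷ʳ_)
open import Data.Bool using (Bool; true; false)
open import Data.Unit using (⊤; tt)
open import Data.Empty using (⊥)
open import Data.Product using (Σ; _×_; _,_; ∃; ∃-syntax)
open import Relation.Nullary using (¬_)
open import Relation.Binary.PropositionalEquality using (_≡_)
open import Function.Definitions using (Injective)
open import Function.Bundles using (_⇔_)

-- Nodes are words over a direction set D (chosen per tree); the children
-- of w are the words w ∷ʳ d that belong to T.
record KripkeTree (AP : Set) : Set₁ where
  field
    D       : Set
    T       : List D → Set
    root∈   : T []
    prefix  : ∀ w d → T (w ∷ʳ d) → T w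
    nonblock : ∀ w → T w → ∃[ d ] T (w ∷ʳ d)
    Lab     : List D → AP → Bool

open KripkeTree public

module _ {AP : Set} (𝒯 : KripkeTree AP) where

  IsChild : List (D 𝒯) → List (D 𝒯) → Set
  IsChild w v = ∃[ d ] (v ≡ w ∷ʳ d × T 𝒯 v)

  record Path (w : List (D 𝒯)) : Set where
    field
      π      : ℕ → List (D 𝒯)
      start  : π 0 ≡ w
      step   : ∀ k → IsChild (π k) (π (suc k))

  open Path public

mutual
  data SFormula (AP : Set) : Set where
    ⊤ₛ  : SFormula AP
    atom : AP → SFormula AP
    ¬ₛ_  : SFormula AP → SFormula AP
    _∧ₛ_ : SFormula AP → SFormula AP → SFormula AP
    E    : PFormula AP → SFormula AP
    Dⁿ   : (n : ℕ) → 1 ≤ n → SFormula AP → SFormula AP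

  data PFormula (AP : Set) : Set where
    state : SFormula AP → PFormula AP
    ¬ₚ_   : PFormula AP → PFormula AP
    _∧ₚ_  : PFormula AP → PFormula AP → PFormula AP
    X     : PFormula AP → PFormula AP
    _U_   : PFormula AP → PFormula AP → PFormula AP

mutual
  _,_⊨ₛ_ : {AP : Set} (𝒯 : KripkeTree AP) → List (D 𝒯) → SFormula AP → Set
  𝒯 , w ⊨ₛ ⊤ₛ = ⊤
  𝒯 , w ⊨ₛ atom p = Lab 𝒯 w p ≡ true
  𝒯 , w ⊨ₛ (¬ₛ φ) = ¬ (𝒯 , w ⊨ₛ φ)
  𝒯 , w ⊨ₛ (φ ∧ₛ φ′) = (𝒯 , w ⊨ₛ φ) × (𝒯 , w ⊨ₛ φ′)
  𝒯 , w ⊨ₛ E ψ = Σ (Path 𝒯 w) λ π → ⊨ₚ 𝒯 (Path.π π) 0 ψ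
  𝒯 , w ⊨ₛ Dⁿ n _ φ =
    Σ (Fin n → D 𝒯) λ f → Injective _≡_ _≡_ f ×
      (∀ i → T 𝒯 (w ∷ʳ f i) × (𝒯 , (w ∷ʳ f i) ⊨ₛ φ))

  ⊨ₚ : {AP : Set} (𝒯 : KripkeTree AP) → (ℕ → List (D 𝒯)) → ℕ → PFormula AP → Set
  ⊨ₚ 𝒯 π i (state φ) = 𝒯 , π i ⊨ₛ φ
  ⊨ₚ 𝒯 π i (¬ₚ ψ) = ¬ ⊨ₚ 𝒯 π i ψ
  ⊨ₚ 𝒯 π i (ψ ∧ₚ ψ′) = ⊨ₚ 𝒯 π i ψ × ⊨ₚ 𝒯 π i ψ′
  ⊨ₚ 𝒯 π i (X ψ) = ⊨ₚ 𝒯 π (suc i) ψ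
  ⊨ₚ 𝒯 π i (ψ U ψ′) =
    ∃[ j ] (i ≤ j × ⊨ₚ 𝒯 π j ψ′ × (∀ k → i ≤ k → k < j → ⊨ₚ 𝒯 π k ψ))

_∈𝓛_ : {AP : Set} → KripkeTree AP → SFormula AP → Set
𝒯 ∈𝓛 φ = 𝒯 , [] ⊨ₛ φ

-- AP = {p}: represented by the one-element type ⊤ with p = tt.
p : ⊤
p = tt

L₂ : KripkeTree ⊤ → Set
L₂ 𝒯 = Σ (Path 𝒯 []) λ π →
  (∀ i → Lab 𝒯 (Path.π π i) p ≡ false) ×
  (∀ i → ∃[ v ] (IsChild 𝒯 (Path.π π (2 * i)) v × Lab 𝒯 v p ≡ true))

-- Let comb S be the tree made of an unlabelled infinite spine whose k-th node has, exactly when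
-- S k holds, a second child rooting a complete binary tree labelled p.  Then comb S ∈ L₂ iff S
-- holds at every even position.  Let trues c τ be the sequence τ preceded by c trues.  By
-- induction on φ, the trees comb (trues (c + 1) τ) and comb (trues c τ) agree on φ once
-- c ≥ rank φ.  A path from the root that leaves the spine early is a path of both trees, and
-- the two trees agree at every node of that path: at spine nodes by induction, and below the
-- spine because all p-labelled nodes are bisimilar.  A path that stays on the spine sees the
-- extra leading true only as a repeated position, and formulas with few nested X cannot see
-- that.  Take τ = false, true, true, … and c odd: the first tree is in L₂ and the second is not.
module Submission where

open import Defs
open import Data.Bool using (Bool; true; false)
open import Data.Bool.ListAction using (or)
open import Data.Bool.Properties using (∨-identityʳ)
open import Data.Empty using (⊥-elim)
open import Data.List using (List; []; _∷_; _∷ʳ_; replicate)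
open import Data.Nat
  using (ℕ; zero; suc; _+_; _*_; _≤_; _<_; _≤′_; ≤′-refl; ≤′-step; z≤n; s≤s; s≤s⁻¹; z<s)
open import Data.Nat.Divisibility using (_∣_; m∣m*n; ∣m+n∣m⇒∣n; ∣1⇒≡1)
open import Data.Nat.Properties
  using ( ≤-refl; ≤-trans; <⇒≤; ≤-<-trans; <-≤-trans; ≤-<-connex; m≤n⇒m<n∨m≡n; ≤⇒≤′
        ; m<n⇒m<1+n; m≤n⇒m≤1+n; m≤m+n; m+n≤o⇒m≤o; m+n≤o⇒n≤o; +-mono-≤; +-comm; *-suc )
open import Data.Product using (Σ; ∃-syntax; _×_; _,_; proj₁; proj₂)
open import Data.Product.Function.NonDependent.Propositional using (_×-⇔_)
open import Data.Sum using (_⊎_; inj₁; inj₂)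
open import Data.Unit using (⊤; tt)
open import Function using (_∘_; flip)
open import Function.Bundles using (_⇔_; mk⇔; Equivalence; _↔_; Inverse; Injection)
open import Function.Construct.Identity using (↔-id)
open import Function.Construct.Symmetry using (↔-sym)
open import Function.Properties.Inverse using (↔⇒↣)
import Function.Properties.Equivalence as ⇔
open import Function.Related.TypeIsomorphisms using (¬-cong-⇔)
open import Relation.Nullary using (¬_; contradiction)
open import Relation.Binary.PropositionalEquality
  using (_≡_; _≢_; refl; sym; trans; cong; subst; subst₂)

open Equivalence using (to; from)

variable
  AP : Set
  𝒯 𝒯′ : KripkeTree AP
  P Q R : SFormula AP → Set

Allₛ : (SFormula AP → Set) → PFormula AP → Set
Allₛ P (state φ) = P φ
Allₛ P (¬ₚ ψ) = Allₛ P ψ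
Allₛ P (ψ ∧ₚ ψ′) = Allₛ P ψ × Allₛ P ψ′
Allₛ P (X ψ) = Allₛ P ψ
Allₛ P (ψ U ψ′) = Allₛ P ψ × Allₛ P ψ′

Allₛ-map : (∀ {φ} → P φ → Q φ) → ∀ ψ → Allₛ P ψ → Allₛ Q ψ
Allₛ-map f (state φ) p = f p
Allₛ-map f (¬ₚ ψ) p = Allₛ-map f ψ p
Allₛ-map f (ψ ∧ₚ ψ′) (p , p′) = Allₛ-map f ψ p , Allₛ-map f ψ′ p′
Allₛ-map f (X ψ) p = Allₛ-map f ψ p
Allₛ-map f (ψ U ψ′) (p , p′) = Allₛ-map f ψ p , Allₛ-map f ψ′ p′

Allₛ-zipWith : (∀ {φ} → P φ → Q φ → R φ) → ∀ ψ → Allₛ P ψ → Allₛ Q ψ → Allₛ R ψ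
Allₛ-zipWith f (state φ) p q = f p q
Allₛ-zipWith f (¬ₚ ψ) p q = Allₛ-zipWith f ψ p q
Allₛ-zipWith f (ψ ∧ₚ ψ′) (p , p′) (q , q′) = Allₛ-zipWith f ψ p q , Allₛ-zipWith f ψ′ p′ q′
Allₛ-zipWith f (X ψ) p q = Allₛ-zipWith f ψ p q
Allₛ-zipWith f (ψ U ψ′) (p , p′) (q , q′) = Allₛ-zipWith f ψ p q , Allₛ-zipWith f ψ′ p′ q′

Allₛ-universal : (∀ φ → P φ) → ∀ ψ → Allₛ P ψ
Allₛ-universal f (state φ) = f φ
Allₛ-universal f (¬ₚ ψ) = Allₛ-universal f ψ
Allₛ-universal f (ψ ∧ₚ ψ′) = Allₛ-universal f ψ , Allₛ-universal f ψ′
Allₛ-universal f (X ψ) = Allₛ-universal f ψ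
Allₛ-universal f (ψ U ψ′) = Allₛ-universal f ψ , Allₛ-universal f ψ′

Agree : PFormula AP → (𝒯 : KripkeTree AP) → List (D 𝒯) → (𝒯′ : KripkeTree AP) → List (D 𝒯′) → Set
Agree ψ 𝒯 w 𝒯′ w′ = Allₛ (λ φ → (𝒯 , w ⊨ₛ φ) ⇔ (𝒯′ , w′ ⊨ₛ φ)) ψ

-- rank φ is the number of leading trues needed in lemma stable.  E ψ pays rankₚ ψ twice: ψ may walk
-- that far down the spine, and a state subformula met on the way needs its own rank of trues below.
mutual
  rank : SFormula AP → ℕ
  rank ⊤ₛ = 0
  rank (atom _) = 0
  rank (¬ₛ φ) = rank φ
  rank (φ ∧ₛ φ′) = rank φ + rank φ′
  rank (E ψ) = rankₚ ψ + rankₚ ψ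
  rank (Dⁿ _ _ φ) = suc (rank φ)

  rankₚ : PFormula AP → ℕ
  rankₚ (state φ) = suc (rank φ)
  rankₚ (¬ₚ ψ) = rankₚ ψ
  rankₚ (ψ ∧ₚ ψ′) = rankₚ ψ + rankₚ ψ′
  rankₚ (X ψ) = suc (rankₚ ψ)
  rankₚ (ψ U ψ′) = rankₚ ψ + rankₚ ψ′

rankₚ-positive : ∀ (ψ : PFormula AP) → 0 < rankₚ ψ
rankₚ-positive (state φ) = z<s
rankₚ-positive (¬ₚ ψ) = rankₚ-positive ψ
rankₚ-positive (ψ ∧ₚ ψ′) = <-≤-trans (rankₚ-positive ψ) (m≤m+n _ _)
rankₚ-positive (X ψ) = z<s
rankₚ-positive (ψ U ψ′) = <-≤-trans (rankₚ-positive ψ) (m≤m+n _ _)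

rank< : ∀ (ψ : PFormula AP) {n} → rankₚ ψ ≤ n → Allₛ (λ φ → rank φ < n) ψ
rank< (state φ) r≤n = r≤n
rank< (¬ₚ ψ) r≤n = rank< ψ r≤n
rank< (ψ ∧ₚ ψ′) r≤n = rank< ψ (m+n≤o⇒m≤o _ r≤n) , rank< ψ′ (m+n≤o⇒n≤o _ r≤n)
rank< (X ψ) r≤n = rank< ψ (<⇒≤ r≤n)
rank< (ψ U ψ′) r≤n = rank< ψ (m+n≤o⇒m≤o _ r≤n) , rank< ψ′ (m+n≤o⇒n≤o _ r≤n)

⊨ₚ-cong : ∀ ψ {σ : ℕ → List (D 𝒯)} {σ′ : ℕ → List (D 𝒯′)} →
          (∀ k → Agree ψ 𝒯 (σ k) 𝒯′ (σ′ k)) → ∀ i → ⊨ₚ 𝒯 σ i ψ ⇔ ⊨ₚ 𝒯′ σ′ i ψ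
⊨ₚ-cong (state φ) agree i = agree i
⊨ₚ-cong (¬ₚ ψ) agree i = ¬-cong-⇔ (⊨ₚ-cong ψ agree i)
⊨ₚ-cong (ψ ∧ₚ ψ′) agree i = ⊨ₚ-cong ψ (proj₁ ∘ agree) i ×-⇔ ⊨ₚ-cong ψ′ (proj₂ ∘ agree) i
⊨ₚ-cong (X ψ) agree i = ⊨ₚ-cong ψ agree (suc i)
⊨ₚ-cong {𝒯 = 𝒯} {𝒯′ = 𝒯′} (ψ U ψ′) {σ} {σ′} agree i =
  mk⇔ (λ (j , i≤j , now , before) →
         j , i≤j , to (later j) now , λ k i≤k k<j → to (earlier k) (before k i≤k k<j))
      (λ (j , i≤j , now , before) →
         j , i≤j , from (later j) now , λ k i≤k k<j → from (earlier k) (before k i≤k k<j))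
  where
    earlier : ∀ k → ⊨ₚ 𝒯 σ k ψ ⇔ ⊨ₚ 𝒯′ σ′ k ψ
    earlier = ⊨ₚ-cong ψ (proj₁ ∘ agree)
    later : ∀ k → ⊨ₚ 𝒯 σ k ψ′ ⇔ ⊨ₚ 𝒯′ σ′ k ψ′
    later = ⊨ₚ-cong ψ′ (proj₂ ∘ agree)

⊨ₚ-suc : ∀ ψ (σ : ℕ → List (D 𝒯)) i → ⊨ₚ 𝒯 σ (suc i) ψ ⇔ ⊨ₚ 𝒯 (σ ∘ suc) i ψ
⊨ₚ-suc (state φ) σ i = ⇔.refl
⊨ₚ-suc (¬ₚ ψ) σ i = ¬-cong-⇔ (⊨ₚ-suc ψ σ i)
⊨ₚ-suc (ψ ∧ₚ ψ′) σ i = ⊨ₚ-suc ψ σ i ×-⇔ ⊨ₚ-suc ψ′ σ i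
⊨ₚ-suc (X ψ) σ i = ⊨ₚ-suc ψ σ (suc i)
⊨ₚ-suc {𝒯 = 𝒯} (ψ U ψ′) σ i = mk⇔ forward backward
  where
    forward : ⊨ₚ 𝒯 σ (suc i) (ψ U ψ′) → ⊨ₚ 𝒯 (σ ∘ suc) i (ψ U ψ′)
    forward (suc j , s≤s i≤j , now , before) =
      j , i≤j , to (⊨ₚ-suc ψ′ σ j) now ,
      λ k i≤k k<j → to (⊨ₚ-suc ψ σ k) (before (suc k) (s≤s i≤k) (s≤s k<j))
    backward : ⊨ₚ 𝒯 (σ ∘ suc) i (ψ U ψ′) → ⊨ₚ 𝒯 σ (suc i) (ψ U ψ′)
    backward (j , i≤j , now , before) = suc j , s≤s i≤j , from (⊨ₚ-suc ψ′ σ j) now , before′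
      where
        before′ : ∀ k → suc i ≤ k → k < suc j → ⊨ₚ 𝒯 σ k ψ
        before′ (suc k) (s≤s i≤k) (s≤s k<j) = from (⊨ₚ-suc ψ σ k) (before k i≤k k<j)

-- The hypotheses say that σ′ is σ with its first position repeated, inside a constant prefix of
-- length m ≥ rankₚ ψ.  Nested X reach at most rankₚ ψ steps, and U is blind to repetitions.
⊨ₚ-stutter : ∀ ψ {m} → rankₚ ψ ≤ m → (σ′ : ℕ → List (D 𝒯′)) (σ : ℕ → List (D 𝒯)) →
             (∀ k → Agree ψ 𝒯′ (σ′ (suc k)) 𝒯 (σ k)) →
             (∀ k → k < m → Agree ψ 𝒯′ (σ′ k) 𝒯′ (σ′ (suc k))) →
             ⊨ₚ 𝒯′ σ′ 0 ψ ⇔ ⊨ₚ 𝒯 σ 0 ψ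
⊨ₚ-stutter (state φ) (s≤s _) σ′ σ shifted stutters = ⇔.trans (stutters 0 z<s) (shifted 0)
⊨ₚ-stutter (¬ₚ ψ) r≤m σ′ σ shifted stutters = ¬-cong-⇔ (⊨ₚ-stutter ψ r≤m σ′ σ shifted stutters)
⊨ₚ-stutter (ψ ∧ₚ ψ′) r≤m σ′ σ shifted stutters =
  ⊨ₚ-stutter ψ (m+n≤o⇒m≤o _ r≤m) σ′ σ (proj₁ ∘ shifted) (λ k k<m → proj₁ (stutters k k<m)) ×-⇔
  ⊨ₚ-stutter ψ′ (m+n≤o⇒n≤o _ r≤m) σ′ σ (proj₂ ∘ shifted) (λ k k<m → proj₂ (stutters k k<m))
⊨ₚ-stutter (X ψ) (s≤s r≤m) σ′ σ shifted stutters =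
  ⇔.trans (⊨ₚ-suc ψ σ′ 0)
    (⇔.trans (⊨ₚ-stutter ψ r≤m (σ′ ∘ suc) (σ ∘ suc) (shifted ∘ suc)
                         (λ k k<m → stutters (suc k) (s≤s k<m)))
      (⇔.sym (⊨ₚ-suc ψ σ 0)))
⊨ₚ-stutter {𝒯′ = 𝒯′} {𝒯 = 𝒯} (ψ U ψ′) r≤m σ′ σ shifted stutters = mk⇔ forward backward
  where
    now : ⊨ₚ 𝒯′ σ′ 0 ψ ⇔ ⊨ₚ 𝒯 σ 0 ψ
    now = ⊨ₚ-stutter ψ (m+n≤o⇒m≤o _ r≤m) σ′ σ (proj₁ ∘ shifted) (λ k k<m → proj₁ (stutters k k<m))
    now′ : ⊨ₚ 𝒯′ σ′ 0 ψ′ ⇔ ⊨ₚ 𝒯 σ 0 ψ′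
    now′ = ⊨ₚ-stutter ψ′ (m+n≤o⇒n≤o _ r≤m) σ′ σ (proj₂ ∘ shifted) (λ k k<m → proj₂ (stutters k k<m))
    next : ∀ k → ⊨ₚ 𝒯′ σ′ (suc k) ψ ⇔ ⊨ₚ 𝒯 σ k ψ
    next k = ⇔.trans (⊨ₚ-suc ψ σ′ k) (⊨ₚ-cong ψ (proj₁ ∘ shifted) k)
    next′ : ∀ k → ⊨ₚ 𝒯′ σ′ (suc k) ψ′ ⇔ ⊨ₚ 𝒯 σ k ψ′
    next′ k = ⇔.trans (⊨ₚ-suc ψ′ σ′ k) (⊨ₚ-cong ψ′ (proj₂ ∘ shifted) k)
    forward : ⊨ₚ 𝒯′ σ′ 0 (ψ U ψ′) → ⊨ₚ 𝒯 σ 0 (ψ U ψ′)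
    forward (zero , _ , here , _) = 0 , z≤n , to now′ here , λ _ _ ()
    forward (suc j , _ , there , before) =
      j , z≤n , to (next′ j) there , λ k _ k<j → to (next k) (before (suc k) z≤n (s≤s k<j))
    backward : ⊨ₚ 𝒯 σ 0 (ψ U ψ′) → ⊨ₚ 𝒯′ σ′ 0 (ψ U ψ′)
    backward (zero , _ , here , _) = 0 , z≤n , from now′ here , λ _ _ ()
    backward (suc j , _ , there , before) = suc (suc j) , z≤n , from (next′ (suc j)) there , before′
      where
        before′ : ∀ k → 0 ≤ k → k < suc (suc j) → ⊨ₚ 𝒯′ σ′ k ψ
        before′ zero _ _ = from now (before 0 z≤n z<s)
        before′ (suc k) _ (s≤s k<j) = from (next k) (before k z≤n k<j)

-- Bisimulation

-- Children are matched along one fixed bijection of directions, so that Dⁿ is preserved.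
record Bisimulation (𝒯 𝒯′ : KripkeTree AP) (_~_ : List (D 𝒯) → List (D 𝒯′) → Set) : Set where
  field
    directions : D 𝒯 ↔ D 𝒯′
    label : ∀ {w w′} → w ~ w′ → ∀ a → Lab 𝒯 w a ≡ Lab 𝒯′ w′ a
    child : ∀ {w w′} → w ~ w′ → ∀ d → (w ∷ʳ d) ~ (w′ ∷ʳ Inverse.to directions d)
    child∈ : ∀ {w w′} → w ~ w′ → ∀ d → T 𝒯 (w ∷ʳ d) ⇔ T 𝒯′ (w′ ∷ʳ Inverse.to directions d)

module _ {_~_ : List (D 𝒯) → List (D 𝒯′) → Set} (B : Bisimulation 𝒯 𝒯′ _~_) where
  open Bisimulation B
  open Inverse directions using (strictlyInverseˡ) renaming (to to dir; from to dir⁻¹)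

  converse : Bisimulation 𝒯′ 𝒯 (flip _~_)
  converse = record
    { directions = ↔-sym directions
    ; label = λ w~w′ a → sym (label w~w′ a)
    ; child = λ {w′} {w} w~w′ d →
        subst (λ d′ → (w ∷ʳ dir⁻¹ d) ~ (w′ ∷ʳ d′)) (strictlyInverseˡ d) (child w~w′ (dir⁻¹ d))
    ; child∈ = λ {w′} {w} w~w′ d →
        subst (λ d′ → T 𝒯′ (w′ ∷ʳ d′) ⇔ T 𝒯 (w ∷ʳ dir⁻¹ d)) (strictlyInverseˡ d)
              (⇔.sym (child∈ w~w′ (dir⁻¹ d)))
    }

  private
    follow : ∀ {w w′} → w ~ w′ → (ρ : Path 𝒯 w) → ∀ k → Σ (List (D 𝒯′)) (π ρ k ~_)
    follow {w′ = w′} w~w′ ρ zero = w′ , subst (_~ w′) (sym (start ρ)) w~w′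
    follow w~w′ ρ (suc k) =
      let (v′ , v~v′) = follow w~w′ ρ k
          (d , next≡ , _) = step ρ k
      in v′ ∷ʳ dir d , subst (_~ (v′ ∷ʳ dir d)) (sym next≡) (child v~v′ d)

  transfer : ∀ {w w′} → w ~ w′ → Path 𝒯 w → Path 𝒯′ w′
  π (transfer w~w′ ρ) k = proj₁ (follow w~w′ ρ k)
  start (transfer w~w′ ρ) = refl
  step (transfer w~w′ ρ) k =
    let (v′ , v~v′) = follow w~w′ ρ k
        (d , next≡ , next∈) = step ρ k
    in dir d , refl , to (child∈ v~v′ d) (subst (T 𝒯) next≡ next∈)

  transfer-related : ∀ {w w′} (w~w′ : w ~ w′) (ρ : Path 𝒯 w) → ∀ k → π ρ k ~ π (transfer w~w′ ρ) k
  transfer-related w~w′ ρ k = proj₂ (follow w~w′ ρ k)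

mutual
  preserves : ∀ {_~_ : List (D 𝒯) → List (D 𝒯′) → Set} → Bisimulation 𝒯 𝒯′ _~_ →
              ∀ {w w′} → w ~ w′ → ∀ φ → 𝒯 , w ⊨ₛ φ → 𝒯′ , w′ ⊨ₛ φ
  preserves B w~w′ ⊤ₛ _ = tt
  preserves B w~w′ (atom a) holds = trans (sym (Bisimulation.label B w~w′ a)) holds
  preserves B w~w′ (¬ₛ φ) fails holds = fails (preserves (converse B) w~w′ φ holds)
  preserves B w~w′ (φ ∧ₛ φ′) (holds , holds′) =
    preserves B w~w′ φ holds , preserves B w~w′ φ′ holds′
  preserves B w~w′ (E ψ) (ρ , holds) =
    transfer B w~w′ ρ ,
    to (⊨ₚ-cong ψ (λ k → ⊨-invariantₛ B (transfer-related B w~w′ ρ k) ψ) 0) holds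
  preserves B w~w′ (Dⁿ n _ φ) (f , f-injective , children) =
    Inverse.to directions ∘ f ,
    f-injective ∘ Injection.injective (↔⇒↣ directions) ,
    λ i → to (child∈ w~w′ (f i)) (proj₁ (children i)) ,
          preserves B (child w~w′ (f i)) φ (proj₂ (children i))
    where open Bisimulation B

  ⊨-invariant : ∀ {_~_ : List (D 𝒯) → List (D 𝒯′) → Set} → Bisimulation 𝒯 𝒯′ _~_ →
                ∀ {w w′} → w ~ w′ → ∀ φ → (𝒯 , w ⊨ₛ φ) ⇔ (𝒯′ , w′ ⊨ₛ φ)
  ⊨-invariant B w~w′ φ = mk⇔ (preserves B w~w′ φ) (preserves (converse B) w~w′ φ)

  ⊨-invariantₛ : ∀ {_~_ : List (D 𝒯) → List (D 𝒯′) → Set} → Bisimulation 𝒯 𝒯′ _~_ →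
                 ∀ {w w′} → w ~ w′ → ∀ ψ → Agree ψ 𝒯 w 𝒯′ w′
  ⊨-invariantₛ B w~w′ (state φ) = ⊨-invariant B w~w′ φ
  ⊨-invariantₛ B w~w′ (¬ₚ ψ) = ⊨-invariantₛ B w~w′ ψ
  ⊨-invariantₛ B w~w′ (ψ ∧ₚ ψ′) = ⊨-invariantₛ B w~w′ ψ , ⊨-invariantₛ B w~w′ ψ′
  ⊨-invariantₛ B w~w′ (X ψ) = ⊨-invariantₛ B w~w′ ψ
  ⊨-invariantₛ B w~w′ (ψ U ψ′) = ⊨-invariantₛ B w~w′ ψ , ⊨-invariantₛ B w~w′ ψ′

Path-tail : ∀ {w} (ρ : Path 𝒯 w) → Path 𝒯 (π ρ 1)
π (Path-tail ρ) = π ρ ∘ suc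
start (Path-tail ρ) = refl
step (Path-tail ρ) = step ρ ∘ suc

Path-cons : ∀ {w v} → IsChild 𝒯 w v → Path 𝒯 v → Path 𝒯 w
π (Path-cons {w = w} _ ρ) zero = w
π (Path-cons _ ρ) (suc k) = π ρ k
start (Path-cons _ ρ) = refl
step (Path-cons {𝒯 = 𝒯} (d , v≡ , v∈) ρ) zero =
  d , trans (start ρ) v≡ , subst (T 𝒯) (sym (start ρ)) v∈
step (Path-cons _ ρ) (suc k) = step ρ k

-- Combs

-- The nodes are the spine words falseᵏ and the words falseᵏ ++ true ∷ u with S k; p holds exactly
-- at the nodes off the spine.
Member : (ℕ → Bool) → List Bool → Set
Member S [] = ⊤
Member S (false ∷ w) = Member (S ∘ suc) w
Member S (true ∷ _) = S 0 ≡ true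

member-prefix : ∀ S w d → Member S (w ∷ʳ d) → Member S w
member-prefix S [] d _ = tt
member-prefix S (false ∷ w) d w∈ = member-prefix (S ∘ suc) w d w∈
member-prefix S (true ∷ w) d w∈ = w∈

member-∷ʳ-false : ∀ S w → Member S w → Member S (w ∷ʳ false)
member-∷ʳ-false S [] _ = tt
member-∷ʳ-false S (false ∷ w) w∈ = member-∷ʳ-false (S ∘ suc) w w∈
member-∷ʳ-false S (true ∷ w) w∈ = w∈

comb : (ℕ → Bool) → KripkeTree ⊤
comb S = record
  { D = Bool
  ; T = Member S
  ; root∈ = tt
  ; prefix = member-prefix S
  ; nonblock = λ w w∈ → false , member-∷ʳ-false S w w∈
  ; Lab = λ w _ → or w
  }

spine : ℕ → List Bool
spine k = replicate k false

spine-∷ʳ-false : ∀ k → spine k ∷ʳ false ≡ spine (suc k)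
spine-∷ʳ-false zero = refl
spine-∷ʳ-false (suc k) = cong (false ∷_) (spine-∷ʳ-false k)

or-spine : ∀ k → or (spine k) ≡ false
or-spine zero = refl
or-spine (suc k) = or-spine k

or-spine-∷ʳ : ∀ k d → or (spine k ∷ʳ d) ≡ d
or-spine-∷ʳ zero d = ∨-identityʳ d
or-spine-∷ʳ (suc k) d = or-spine-∷ʳ k d

member-spine : ∀ S k → Member S (spine k)
member-spine S zero = tt
member-spine S (suc k) = member-spine (S ∘ suc) k

member-spine-∷ʳ-true : ∀ S k → Member S (spine k ∷ʳ true) ⇔ (S k ≡ true)
member-spine-∷ʳ-true S zero = ⇔.refl
member-spine-∷ʳ-true S (suc k) = member-spine-∷ʳ-true (S ∘ suc) k

shift : ∀ S → Bisimulation (comb S) (comb (S ∘ suc)) (λ w w′ → w ≡ false ∷ w′)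
shift S = record
  { directions = ↔-id Bool
  ; label = λ { refl _ → refl }
  ; child = λ { refl _ → refl }
  ; child∈ = λ { refl _ → ⇔.refl }
  }

⊨-shift : ∀ S w φ → (comb S , false ∷ w ⊨ₛ φ) ⇔ (comb (S ∘ suc) , w ⊨ₛ φ)
⊨-shift S w = ⊨-invariant (shift S) refl

OffSpine : (ℕ → Bool) → List Bool → Set
OffSpine S w = or w ≡ true × Member S w

offSpine-∷ʳ : ∀ S w → OffSpine S w → ∀ d → OffSpine S (w ∷ʳ d)
offSpine-∷ʳ S [] (() , _) d
offSpine-∷ʳ S (true ∷ w) (_ , w∈) d = refl , w∈
offSpine-∷ʳ S (false ∷ w) off d = offSpine-∷ʳ (S ∘ suc) w off d

-- Every node off the spine roots a complete binary tree labelled p.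
offSpine : ∀ S S′ → Bisimulation (comb S) (comb S′) (λ w w′ → OffSpine S w × OffSpine S′ w′)
offSpine S S′ = record
  { directions = ↔-id Bool
  ; label = λ ((labelled , _) , (labelled′ , _)) _ → trans labelled (sym labelled′)
  ; child = λ {w} {w′} (off , off′) d → offSpine-∷ʳ S w off d , offSpine-∷ʳ S′ w′ off′ d
  ; child∈ = λ {w} {w′} (off , off′) d →
      mk⇔ (λ _ → proj₂ (offSpine-∷ʳ S′ w′ off′ d)) (λ _ → proj₂ (offSpine-∷ʳ S w off d))
  }

⊨-offSpine : ∀ {S S′ w w′} → OffSpine S w → OffSpine S′ w′ →
             ∀ φ → (comb S , w ⊨ₛ φ) ⇔ (comb S′ , w′ ⊨ₛ φ)
⊨-offSpine off off′ = ⊨-invariant (offSpine _ _) (off , off′)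

retarget : ∀ {S S′ w} (ρ : Path (comb S) w) → (∀ k → Member S′ (π ρ k)) → Path (comb S′) w
π (retarget ρ _) = π ρ
start (retarget ρ _) = start ρ
step (retarget ρ members) k = let (d , next≡ , _) = step ρ k in d , next≡ , members (suc k)

module _ {S} (ρ : Path (comb S) []) where

  OnSpineUpTo : ℕ → Set
  OnSpineUpTo n = ∀ k → k ≤ n → π ρ k ≡ spine k

  LeavesSpineAt : ℕ → Set
  LeavesSpineAt j = OnSpineUpTo j × π ρ (suc j) ≡ spine j ∷ʳ true

  stays-or-leaves : ∀ n → OnSpineUpTo n ⊎ ∃[ j ] (j < n × LeavesSpineAt j)
  stays-or-leaves zero = inj₁ λ { zero z≤n → start ρ }
  stays-or-leaves (suc n) with stays-or-leaves n
  ... | inj₂ (j , j<n , leaves) = inj₂ (j , m<n⇒m<1+n j<n , leaves)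
  ... | inj₁ on with step ρ n
  ...   | true , next≡ , _ = inj₂ (n , ≤-refl , on , trans next≡ (cong (_∷ʳ true) (on n ≤-refl)))
  ...   | false , next≡ , _ = inj₁ on′
    where
      on′ : OnSpineUpTo (suc n)
      on′ k k≤1+n with m≤n⇒m<n∨m≡n k≤1+n
      ... | inj₁ k<1+n = on k (s≤s⁻¹ k<1+n)
      ... | inj₂ refl = trans next≡ (trans (cong (_∷ʳ false) (on n ≤-refl)) (spine-∷ʳ-false n))

  offSpine-after : ∀ {j} → LeavesSpineAt j → ∀ {S′} → S′ j ≡ true →
                   ∀ {k} → j ≤′ k → OffSpine S′ (π ρ (suc k))
  offSpine-after {j} (_ , exit) {S′} S′j ≤′-refl =
    subst (OffSpine S′) (sym exit) (or-spine-∷ʳ j true , from (member-spine-∷ʳ-true S′ j) S′j)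
  offSpine-after leaves {S′} S′j (≤′-step {k} j≤k) =
    let (d , next≡ , _) = step ρ (suc k)
        off = offSpine-after leaves {S′} S′j j≤k
    in subst (OffSpine S′) (sym next≡) (offSpine-∷ʳ S′ (π ρ (suc k)) off d)

E-leaving : ∀ {S S′} ψ (ρ : Path (comb S) []) {j} → LeavesSpineAt ρ j → S′ j ≡ true →
            (∀ k → k ≤ j → Agree ψ (comb S) (spine k) (comb S′) (spine k)) →
            ⊨ₚ (comb S) (π ρ) 0 ψ → comb S′ , [] ⊨ₛ E ψ
E-leaving {S} {S′} ψ ρ {j} leaves@(on , exit) S′j agree holds =
  retarget ρ members , to (⊨ₚ-cong ψ agree-along 0) holds
  where
    Sj : S j ≡ true
    Sj = to (member-spine-∷ʳ-true S j) (subst (Member S) exit (proj₂ (proj₂ (step ρ j))))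
    members : ∀ k → Member S′ (π ρ k)
    members k with ≤-<-connex k j
    ... | inj₁ k≤j = subst (Member S′) (sym (on k k≤j)) (member-spine S′ k)
    members (suc k) | inj₂ j<1+k = proj₂ (offSpine-after ρ leaves S′j (≤⇒≤′ (s≤s⁻¹ j<1+k)))
    agree-along : ∀ k → Agree ψ (comb S) (π ρ k) (comb S′) (π ρ k)
    agree-along k with ≤-<-connex k j
    ... | inj₁ k≤j = subst (λ w → Agree ψ (comb S) w (comb S′) w) (sym (on k k≤j)) (agree k k≤j)
    agree-along (suc k) | inj₂ j<1+k =
      Allₛ-universal (⊨-offSpine (offSpine-after ρ leaves Sj j≤k) (offSpine-after ρ leaves S′j j≤k)) ψ
      where
        j≤k : j ≤′ k
        j≤k = ≤⇒≤′ (s≤s⁻¹ j<1+k)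

Stutters : (ℕ → Bool) → PFormula ⊤ → ℕ → Set
Stutters S ψ n = ∀ k → k < n → Agree ψ (comb S) (spine k) (comb S) (spine (suc k))

⊨ₚ-spine-shift : ∀ S ψ → Stutters S ψ (rankₚ ψ) → {σ σ′ : ℕ → List Bool} →
                 (∀ k → k ≤ rankₚ ψ → σ k ≡ spine k) → (∀ k → σ (suc k) ≡ false ∷ σ′ k) →
                 ⊨ₚ (comb S) σ 0 ψ ⇔ ⊨ₚ (comb (S ∘ suc)) σ′ 0 ψ
⊨ₚ-spine-shift S ψ stutters {σ} {σ′} on shifted = ⊨ₚ-stutter ψ ≤-refl σ σ′ shifted′ stutters′
  where
    shifted′ : ∀ k → Agree ψ (comb S) (σ (suc k)) (comb (S ∘ suc)) (σ′ k)
    shifted′ k = subst (λ w → Agree ψ (comb S) w (comb (S ∘ suc)) (σ′ k)) (sym (shifted k))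
                       (⊨-invariantₛ (shift S) refl ψ)
    stutters′ : ∀ k → k < rankₚ ψ → Agree ψ (comb S) (σ k) (comb S) (σ (suc k))
    stutters′ k k<n = subst₂ (λ w w′ → Agree ψ (comb S) w (comb S) w′)
                             (sym (on k (<⇒≤ k<n))) (sym (on (suc k) k<n)) (stutters k k<n)

E-drop : ∀ S ψ → Stutters S ψ (rankₚ ψ) → (ρ : Path (comb S) []) → OnSpineUpTo ρ (rankₚ ψ) →
         ⊨ₚ (comb S) (π ρ) 0 ψ → comb (S ∘ suc) , [] ⊨ₛ E ψ
E-drop S ψ stutters ρ on holds =
  ρ′ , to (⊨ₚ-spine-shift S ψ stutters on (transfer-related (shift S) second (Path-tail ρ))) holds
  where
    second : π ρ 1 ≡ false ∷ []
    second = on 1 (rankₚ-positive ψ)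
    ρ′ : Path (comb (S ∘ suc)) []
    ρ′ = transfer (shift S) second (Path-tail ρ)

E-push : ∀ S ψ → Stutters S ψ (rankₚ ψ) → (ρ : Path (comb (S ∘ suc)) []) → OnSpineUpTo ρ (rankₚ ψ) →
         ⊨ₚ (comb (S ∘ suc)) (π ρ) 0 ψ → comb S , [] ⊨ₛ E ψ
E-push S ψ stutters ρ on holds = ρ′ , from (⊨ₚ-spine-shift S ψ stutters on′ shifted) holds
  where
    ρ′ : Path (comb S) []
    ρ′ = Path-cons (false , refl , tt) (transfer (converse (shift S)) refl ρ)
    shifted : ∀ k → π ρ′ (suc k) ≡ false ∷ π ρ k
    shifted = transfer-related (converse (shift S)) refl ρ
    on′ : ∀ k → k ≤ rankₚ ψ → π ρ′ k ≡ spine k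
    on′ zero _ = refl
    on′ (suc k) k<n = trans (shifted k) (cong (false ∷_) (on k (<⇒≤ k<n)))

-- Stability under one more leading true

trues : ℕ → (ℕ → Bool) → ℕ → Bool
trues zero τ j = τ j
trues (suc c) τ zero = true
trues (suc c) τ (suc j) = trues c τ j

trues-< : ∀ c τ {j} → j < c → trues c τ j ≡ true
trues-< (suc c) τ {zero} _ = refl
trues-< (suc c) τ {suc j} (s≤s j<c) = trues-< c τ j<c

RootStable : SFormula ⊤ → Set
RootStable φ =
  ∀ τ c → rank φ ≤ c → (comb (trues (suc c) τ) , [] ⊨ₛ φ) ⇔ (comb (trues c τ) , [] ⊨ₛ φ)

stable-spine : ∀ {φ} → RootStable φ → ∀ τ k a → k + rank φ ≤ a →
               (comb (trues (suc a) τ) , spine k ⊨ₛ φ) ⇔ (comb (trues a τ) , spine k ⊨ₛ φ)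
stable-spine stable τ zero a r≤a = stable τ a r≤a
stable-spine {φ} stable τ (suc k) (suc a) (s≤s k+r≤a) =
  ⇔.trans (⊨-shift (trues (suc (suc a)) τ) (spine k) φ)
    (⇔.trans (stable-spine stable τ k a k+r≤a) (⇔.sym (⊨-shift (trues (suc a) τ) (spine k) φ)))

stable-E : ∀ ψ → Allₛ RootStable ψ → RootStable (E ψ)
stable-E ψ stable τ a 2n≤a = mk⇔ forward backward
  where
    n : ℕ
    n = rankₚ ψ
    S₊ S₀ : ℕ → Bool
    S₊ = trues (suc a) τ
    S₀ = trues a τ
    j<a : ∀ {j} → j < n → j < a
    j<a j<n = <-≤-trans j<n (m+n≤o⇒m≤o n 2n≤a)
    agree : ∀ k → k < n → Agree ψ (comb S₊) (spine k) (comb S₀) (spine k)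
    agree k k<n =
      Allₛ-zipWith (λ stableφ φ<n → stable-spine stableφ τ k a (k+φ≤a φ<n)) ψ stable (rank< ψ ≤-refl)
      where
        k+φ≤a : ∀ {r} → r < n → k + r ≤ a
        k+φ≤a r<n = ≤-trans (+-mono-≤ (<⇒≤ k<n) (<⇒≤ r<n)) 2n≤a
    stutters : Stutters S₊ ψ n
    stutters k k<n =
      Allₛ-map (λ {φ} agreeφ → ⇔.trans agreeφ (⇔.sym (⊨-shift S₊ (spine k) φ))) ψ (agree k k<n)
    forward : comb S₊ , [] ⊨ₛ E ψ → comb S₀ , [] ⊨ₛ E ψ
    forward (ρ , holds) with stays-or-leaves ρ n
    ... | inj₁ on = E-drop S₊ ψ stutters ρ on holds
    ... | inj₂ (j , j<n , leaves) =
      E-leaving ψ ρ leaves (trues-< a τ (j<a j<n)) (λ k k≤j → agree k (≤-<-trans k≤j j<n)) holds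
    backward : comb S₀ , [] ⊨ₛ E ψ → comb S₊ , [] ⊨ₛ E ψ
    backward (ρ , holds) with stays-or-leaves ρ n
    ... | inj₁ on = E-push S₊ ψ stutters ρ on holds
    ... | inj₂ (j , j<n , leaves) =
      E-leaving ψ ρ leaves (trues-< (suc a) τ (m<n⇒m<1+n (j<a j<n)))
                (λ k k≤j → Allₛ-map ⇔.sym ψ (agree k (≤-<-trans k≤j j<n))) holds

stable-Dⁿ : ∀ n n≥1 φ → RootStable φ → RootStable (Dⁿ n n≥1 φ)
stable-Dⁿ n _ φ stable τ (suc c) (s≤s r≤c) =
  mk⇔ (λ (f , f-injective , children) → f , f-injective , λ i → to (agree (f i)) (children i))
      (λ (f , f-injective , children) → f , f-injective , λ i → from (agree (f i)) (children i))
  where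
    S₊ S₀ : ℕ → Bool
    S₊ = trues (suc (suc c)) τ
    S₀ = trues (suc c) τ
    agree : ∀ d → (Member S₊ (d ∷ []) × (comb S₊ , d ∷ [] ⊨ₛ φ))
                ⇔ (Member S₀ (d ∷ []) × (comb S₀ , d ∷ [] ⊨ₛ φ))
    agree false = ⇔.refl ×-⇔ stable-spine stable τ 1 (suc c) (s≤s r≤c)
    agree true = ⇔.refl ×-⇔ ⊨-offSpine (refl , refl) (refl , refl) φ

mutual
  stable : ∀ φ → RootStable φ
  stable ⊤ₛ τ c _ = ⇔.refl
  stable (atom _) τ c _ = ⇔.refl
  stable (¬ₛ φ) τ c r≤c = ¬-cong-⇔ (stable φ τ c r≤c)
  stable (φ ∧ₛ φ′) τ c r≤c = stable φ τ c (m+n≤o⇒m≤o _ r≤c) ×-⇔ stable φ′ τ c (m+n≤o⇒n≤o _ r≤c)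
  stable (E ψ) = stable-E ψ (stableₛ ψ)
  stable (Dⁿ n n≥1 φ) = stable-Dⁿ n n≥1 φ (stable φ)

  stableₛ : ∀ ψ → Allₛ RootStable ψ
  stableₛ (state φ) = stable φ
  stableₛ (¬ₚ ψ) = stableₛ ψ
  stableₛ (ψ ∧ₚ ψ′) = stableₛ ψ , stableₛ ψ′
  stableₛ (X ψ) = stableₛ ψ
  stableₛ (ψ U ψ′) = stableₛ ψ , stableₛ ψ′

spinePath : ∀ S → Path (comb S) []
π (spinePath S) = spine
start (spinePath S) = refl
step (spinePath S) k = false , sym (spine-∷ʳ-false k) , member-spine S (suc k)

unlabelled-path-is-spine : ∀ {S} (ρ : Path (comb S) []) → (∀ k → or (π ρ k) ≡ false) →
                           ∀ k → π ρ k ≡ spine k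
unlabelled-path-is-spine ρ unlabelled zero = start ρ
unlabelled-path-is-spine ρ unlabelled (suc k) =
  trans next≡ (trans (cong (spine k ∷ʳ_) d≡false) (spine-∷ʳ-false k))
  where
    d : Bool
    d = proj₁ (step ρ k)
    next≡ : π ρ (suc k) ≡ spine k ∷ʳ d
    next≡ = trans (proj₁ (proj₂ (step ρ k))) (cong (_∷ʳ d) (unlabelled-path-is-spine ρ unlabelled k))
    d≡false : d ≡ false
    d≡false = trans (sym (or-spine-∷ʳ k d)) (trans (cong or (sym next≡)) (unlabelled (suc k)))

labelled-child : ∀ S k {v} → IsChild (comb S) (spine k) v → or v ≡ true → S k ≡ true
labelled-child S k (d , refl , v∈) labelled with trans (sym (or-spine-∷ʳ k d)) labelled
... | refl = to (member-spine-∷ʳ-true S k) v∈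

L₂-comb : ∀ S → L₂ (comb S) ⇔ (∀ i → S (2 * i) ≡ true)
L₂-comb S = mk⇔ necessary sufficient
  where
    necessary : L₂ (comb S) → ∀ i → S (2 * i) ≡ true
    necessary (ρ , unlabelled , labelled-children) i =
      let (v , child , labelled) = labelled-children i
          on = unlabelled-path-is-spine ρ unlabelled (2 * i)
      in labelled-child S (2 * i) (subst (λ w → IsChild (comb S) w v) on child) labelled
    sufficient : (∀ i → S (2 * i) ≡ true) → L₂ (comb S)
    sufficient evens =
      spinePath S , or-spine ,
      λ i → spine (2 * i) ∷ʳ true ,
            (true , refl , from (member-spine-∷ʳ-true S (2 * i)) (evens i)) ,
            or-spine-∷ʳ (2 * i) true

isSuc : ℕ → Bool
isSuc zero = false
isSuc (suc _) = true

trues-isSuc : ∀ c j → j ≢ c → trues c isSuc j ≡ true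
trues-isSuc zero zero j≢c = ⊥-elim (j≢c refl)
trues-isSuc zero (suc j) _ = refl
trues-isSuc (suc c) zero _ = refl
trues-isSuc (suc c) (suc j) j≢c = trues-isSuc c j (j≢c ∘ cong suc)

trues-isSuc-self : ∀ c → trues c isSuc c ≡ false
trues-isSuc-self zero = refl
trues-isSuc-self (suc c) = trues-isSuc-self c

2*m≢1+2*n : ∀ m n → 2 * m ≢ suc (2 * n)
2*m≢1+2*n m n 2m≡1+2n = contradiction (∣1⇒≡1 (∣m+n∣m⇒∣n 2∣2n+1 (m∣m*n n))) λ ()
  where
    2∣2n+1 : 2 ∣ 2 * n + 1
    2∣2n+1 = subst (2 ∣_) (trans 2m≡1+2n (+-comm 1 (2 * n))) (m∣m*n m)

corollary24 : ¬ (∃[ φ ] (∀ (𝒯 : KripkeTree ⊤) → (𝒯 ∈𝓛 φ) ⇔ L₂ 𝒯))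
corollary24 (φ , 𝓛φ⇔L₂) = contradiction (trans (sym hole) (evens-after (suc N))) λ ()
  where
    N c : ℕ
    N = rank φ
    c = suc (2 * N)
    L₂-agree : L₂ (comb (trues (suc c) isSuc)) ⇔ L₂ (comb (trues c isSuc))
    L₂-agree = ⇔.trans (⇔.sym (𝓛φ⇔L₂ _)) (⇔.trans (stable φ isSuc c (m≤n⇒m≤1+n (m≤m+n N _))) (𝓛φ⇔L₂ _))
    evens-before : ∀ i → trues c isSuc (2 * i) ≡ true
    evens-before i = trues-isSuc c (2 * i) (2*m≢1+2*n i N)
    evens-after : ∀ i → trues (suc c) isSuc (2 * i) ≡ true
    evens-after = to (L₂-comb _) (from L₂-agree (from (L₂-comb _) evens-before))
    hole : trues (suc c) isSuc (2 * suc N) ≡ false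
    hole = subst (λ j → trues (suc c) isSuc j ≡ false) (sym (*-suc 2 N)) (trues-isSuc-self (suc c))
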